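{- In every Ex-lattice, for all elements $a,b,c,d$: $\lnot\big(a\wedge((b\wedge c)\vee(b\wedge d))\big)\wedge a\le(b\wedge(c\vee d))\vee\lnot(b\wedge(c\vee d))$.
   Context: A fundamental lattice is a bounded lattice with unary $\lnot$ that is antitone, satisfies $a\wedge\lnot a=0$ and $a\le\lnot\lnot a$. An Ex-lattice is a fundamental lattice in which, for all $a,b,c,d,e,f$: $\lnot\big[a\wedge((b\wedge c)\vee(b\wedge d))\big]\wedge a\wedge(c\vee e)\wedge\lnot\lnot f \le \lnot\lnot(a\wedge f)\wedge\big[(a\wedge c)\vee(a\wedge e)\vee f\big]\wedge\big[(b\wedge(c\vee d))\vee\lnot(b\wedge(c\vee d))\big]$. -}

module Defs where

open import Level using (Level; _⊔_; suc)
open import Algebra.Lattice.Bundles using (Lattice)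

-- Lattice order: x ≤ y iff x ≈ x ∧ y (the convention of
-- Algebra.Lattice.Properties.Lattice in the standard library).

record ExLattice (c ℓ : Level) : Set (suc (c ⊔ ℓ)) where
  field
    lattice : Lattice c ℓ
  open Lattice lattice public
  infix 4 _≤_
  _≤_ : Carrier → Carrier → Set ℓ
  x ≤ y = x ≈ (x ∧ y)
  field
    ⊥ₗ ⊤ₗ : Carrier
    ⊥-least  : ∀ x → ⊥ₗ ≤ x
    ⊤-greatest : ∀ x → x ≤ ⊤ₗ
    ¬_ : Carrier → Carrier
    ¬-antitone : ∀ {x y} → x ≤ y → ¬ y ≤ ¬ x
    ¬-contra   : ∀ x → (x ∧ (¬ x)) ≈ ⊥ₗ
    ¬¬-intro   : ∀ x → x ≤ ¬ (¬ x)
    ex : ∀ a b c d e f →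
      ((((¬ (a ∧ ((b ∧ c) ∨ (b ∧ d)))) ∧ a) ∧ (c ∨ e)) ∧ (¬ (¬ f)))
        ≤ (((¬ (¬ (a ∧ f))) ∧ (((a ∧ c) ∨ (a ∧ e)) ∨ f))
            ∧ ((b ∧ (c ∨ d)) ∨ (¬ (b ∧ (c ∨ d)))))

{-# OPTIONS --safe #-}
module Submission where

open import Defs
open import Level using (Level)
open import Algebra.Lattice.Properties.Lattice using (∨-∧-orderTheoreticLattice)
import Relation.Binary.Lattice as OrderTheoretic
import Relation.Binary.Reasoning.PartialOrder as ≤-Reasoning

-- Instantiating the Ex axiom at e = f = ⊤ collapses its extra conjuncts on the
-- left, and the claim is the last conjunct on the right.

module ExLatticeProperties {c ℓ} (L : ExLattice c ℓ) where

  open ExLattice L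
  open OrderTheoretic.Lattice (∨-∧-orderTheoreticLattice lattice)
    public using (poset; antisym; y≤x∨y; x∧y≤y)

  ∧-identityʳ : ∀ x → (x ∧ ⊤ₗ) ≈ x
  ∧-identityʳ x = sym (⊤-greatest x)

  ∨-zeroʳ : ∀ x → (x ∨ ⊤ₗ) ≈ ⊤ₗ
  ∨-zeroʳ x = antisym (⊤-greatest _) (y≤x∨y x ⊤ₗ)

  ¬¬⊤≈⊤ : (¬ (¬ ⊤ₗ)) ≈ ⊤ₗ
  ¬¬⊤≈⊤ = antisym (⊤-greatest _) (¬¬-intro ⊤ₗ)

lemma3p6 : ∀ {ℓ₁ ℓ₂ : Level} (L : ExLattice ℓ₁ ℓ₂) → let open ExLattice L in
    ∀ a b c d →
      ((¬ (a ∧ ((b ∧ c) ∨ (b ∧ d)))) ∧ a) ≤ ((b ∧ (c ∨ d)) ∨ (¬ (b ∧ (c ∨ d))))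
lemma3p6 L a b c d = begin
  x                                        ≈⟨ ∧-identityʳ x ⟨
  x ∧ ⊤ₗ                                   ≈⟨ ∧-identityʳ _ ⟨
  (x ∧ ⊤ₗ) ∧ ⊤ₗ                            ≈⟨ ∧-cong (∧-cong refl (∨-zeroʳ c)) ¬¬⊤≈⊤ ⟨
  (x ∧ (c ∨ ⊤ₗ)) ∧ (¬ (¬ ⊤ₗ))              ≤⟨ ex a b c d ⊤ₗ ⊤ₗ ⟩
  _ ∧ ((b ∧ (c ∨ d)) ∨ (¬ (b ∧ (c ∨ d))))  ≤⟨ x∧y≤y _ _ ⟩
  (b ∧ (c ∨ d)) ∨ (¬ (b ∧ (c ∨ d)))        ∎
  where
  open ExLattice L
  open ExLatticeProperties L
  open ≤-Reasoning poset
  x : Carrier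
  x = (¬ (a ∧ ((b ∧ c) ∨ (b ∧ d)))) ∧ a
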